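{- For every choice of $\mathbf I_1,\mathbf J_1,\mathbf K_1,\mathbf I_3,\mathbf J_3,\mathbf K_3\in\{0,1\}^k$, $$\sum_{\mathbf A,\mathbf B,\mathbf C\in\{0,1\}^k}R''_{x/y}(\mathbf I_1,\mathbf J_1,\mathbf A,\mathbf B)\,P_x(\mathbf K_1,\mathbf B,\mathbf C,\mathbf J_3)\,P_y(\mathbf C,\mathbf A,\mathbf K_3,\mathbf I_3)=\sum_{\mathbf A,\mathbf B,\mathbf C\in\{0,1\}^k}P_y(\mathbf K_1,\mathbf I_1,\mathbf C,\mathbf A)\,P_x(\mathbf C,\mathbf J_1,\mathbf K_3,\mathbf B)\,R''_{x/y}(\mathbf A,\mathbf B,\mathbf I_3,\mathbf J_3).$$
   Context: Fix $k\ge1$ and an indeterminate $t$. For $\mathbf I\in\{0,1\}^k$ let $|\mathbf I|=\sum_cI_c$; for $\mathbf I,\mathbf J\in\mathbb Z^k$ let $\varphi(\mathbf I,\mathbf J)=\sum_{1\le c<d\le k}I_cJ_d$; let $(a;t)_r=\prod_{s=0}^{r-1}(1-at^s)$. Purple box weight (arguments: bottom, left, top, right edge labels): $P_x(\mathbf I,\mathbf J,\mathbf K,\mathbf L)=\mathbf 1_{\mathbf I+\mathbf J=\mathbf K+\mathbf L}\prod_c\mathbf 1_{K_c\ge J_c}\,x^{|\mathbf L|}t^{\varphi(\mathbf L,\mathbf K-\mathbf J)}$. Cross weight (arguments: bottom-left, top-left, top-right, bottom-right edge labels): $R''_{x/y}(\mathbf I,\mathbf J,\mathbf K,\mathbf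 L)=\mathbf 1_{\mathbf I+\mathbf J=\mathbf K+\mathbf L}\prod_c\mathbf 1_{K_c\ge J_c}\,(x/y)^{|\mathbf L|}(x/y;t)_{|\mathbf K|-|\mathbf J|}\,t^{\varphi(\mathbf L,\mathbf K-\mathbf J)}$. -}

module Defs where

open import Level using (Level)
open import Algebra.Bundles using (CommutativeRing)
open import Data.Bool using (Bool; true; false; _∧_; not; if_then_else_)
open import Data.Nat using (ℕ; zero; suc; _∸_; _≡ᵇ_) renaming (_+_ to _+ℕ_; _*_ to _*ℕ_)
open import Data.Vec using (Vec; []; _∷_)
open import Data.List using (List; []; _∷_; map; _++_; concatMap)

-- Elements of {0,1}^k are vectors of booleans (false = 0, true = 1).
b2n : Bool → ℕ
b2n false = 0
b2n true  = 1

∣_∣ : {k : ℕ} → Vec Bool k → ℕ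
∣ [] ∣ = 0
∣ b ∷ v ∣ = b2n b +ℕ ∣ v ∣

sumℕ : {k : ℕ} → Vec ℕ k → ℕ
sumℕ [] = 0
sumℕ (n ∷ v) = n +ℕ sumℕ v

φ : {k : ℕ} → Vec Bool k → Vec ℕ k → ℕ
φ [] [] = 0
φ (i ∷ I) (j ∷ J) = b2n i *ℕ sumℕ J +ℕ φ I J

-- K − J componentwise (only used when K_c ≥ J_c for all c, where it is exact)
diff : {k : ℕ} → Vec Bool k → Vec Bool k → Vec ℕ k
diff [] [] = []
diff (a ∷ K) (b ∷ J) = (b2n a ∸ b2n b) ∷ diff K J

admissible : {k : ℕ} → Vec Bool k → Vec Bool k → Vec Bool k → Vec Bool k → Bool
admissible [] [] [] [] = true
admissible (i ∷ I) (j ∷ J) (kk ∷ K) (l ∷ L) =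
  ((b2n i +ℕ b2n j) ≡ᵇ (b2n kk +ℕ b2n l)) ∧ not (j ∧ not kk) ∧ admissible I J K L

allVecs : (k : ℕ) → List (Vec Bool k)
allVecs zero = [] ∷ []
allVecs (suc k) = map (false ∷_) (allVecs k) ++ map (true ∷_) (allVecs k)

module Weights {c ℓ : Level} (R : CommutativeRing c ℓ) where
  open CommutativeRing R

  pow : Carrier → ℕ → Carrier
  pow a zero = 1#
  pow a (suc n) = a * pow a n

  poch : Carrier → Carrier → ℕ → Carrier
  poch a t zero = 1#
  poch a t (suc r) = poch a t r * (1# - a * pow t r)

  sumL : {A : Set} → List A → (A → Carrier) → Carrier
  sumL [] f = 0#
  sumL (a ∷ as) f = f a + sumL as f

  Σ𝟚 : (k : ℕ) → (Vec Bool k → Carrier) → Carrier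
  Σ𝟚 k f = sumL (allVecs k) f

  -- purple box P_x(I,J,K,L)  (bottom, left, top, right)
  P : {k : ℕ} → (x t : Carrier) → (I J K L : Vec Bool k) → Carrier
  P x t I J K L =
    if admissible I J K L then pow x ∣ L ∣ * pow t (φ L (diff K J)) else 0#

  -- cross R''_{u}(I,J,K,L) with u = x/y  (bottom-left, top-left, top-right, bottom-right)
  R'' : {k : ℕ} → (u t : Carrier) → (I J K L : Vec Bool k) → Carrier
  R'' u t I J K L =
    if admissible I J K L
    then (pow u ∣ L ∣ * poch u t (∣ K ∣ ∸ ∣ J ∣)) * pow t (φ L (diff K J))
    else 0#

{-# OPTIONS --safe #-}
-- Induction on k, peeling off the first coordinate of every label.  Through φ and the
-- Pochhammer symbol, the first coordinate of a weight leaves behind a modified weight on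
-- the remaining coordinates: its label l twists them by t^(l·|K − J|) and its k − j
-- shifts the Pochhammer index.  So both sides are generalised to lhs/rhs k m r s q, with
-- offset m in (u;t) and twists r, s, q of the cross, the x-box and the y-box, and the
-- identity is proved for every offset m with the y-box twisted by m (for invertible t,
-- the original identity for u t^m and y t^(-m)).  After peeling, each side is a sum of
-- at most two internal first-coordinate configurations, and the 2⁶ boundary cases are
-- settled by three facts about the generalised tails: raising the x-box twist, or the
-- cross and y-box twists together, multiplies by t^(|K₁| − |J₃|) or t^(|K₃| − |J₁|)
-- (conservation of labels), and (u;t)_(n+1) = (u;t)_n (1 − u t^n) relates the offsets
-- m and m + 1.
module Submission where

open import Defs
open import Level using (Level; _⊔_)
open import Algebra.Bundles using (CommutativeRing)
open import Data.Bool using (Bool; true; false; if_then_else_)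
open import Data.Nat using (ℕ; zero; suc; _∸_) renaming (_+_ to _+ℕ_; _*_ to _*ℕ_)
import Data.Nat.Properties as ℕ
open import Data.Vec using (Vec; []; _∷_)
open import Data.List using (List; []; _∷_; map; _++_; concatMap)
open import Data.Product using (_×_; _,_; proj₁; proj₂; uncurry)
open import Function using (_∘_)
open import Relation.Binary.PropositionalEquality as ≡ using (_≡_; cong)
import Algebra.Solver.Ring.NaturalCoefficients.Default as NatCoefficients
open import Data.Nat.Tactic.RingSolver using (solve-∀)

excess : {k : ℕ} → Vec Bool k → Vec Bool k → ℕ
excess K J = sumℕ (diff K J)

admissible⇒excess : {k : ℕ} (I J K L : Vec Bool k) → admissible I J K L ≡ true →
  (excess K J +ℕ ∣ J ∣ ≡ ∣ K ∣) × (excess K J +ℕ ∣ L ∣ ≡ ∣ I ∣)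
admissible⇒excess [] [] [] [] _ = ≡.refl , ≡.refl
admissible⇒excess (false ∷ I) (false ∷ J) (false ∷ K) (false ∷ L) h = admissible⇒excess I J K L h
admissible⇒excess (false ∷ I) (true ∷ J) (true ∷ K) (false ∷ L) h
  with e₁ , e₂ ← admissible⇒excess I J K L h = ≡.trans (ℕ.+-suc _ _) (cong suc e₁) , e₂
admissible⇒excess (true ∷ I) (false ∷ J) (false ∷ K) (true ∷ L) h
  with e₁ , e₂ ← admissible⇒excess I J K L h = e₁ , ≡.trans (ℕ.+-suc _ _) (cong suc e₂)
admissible⇒excess (true ∷ I) (false ∷ J) (true ∷ K) (false ∷ L) h
  with e₁ , e₂ ← admissible⇒excess I J K L h = cong suc e₁ , cong suc e₂
admissible⇒excess (true ∷ I) (true ∷ J) (true ∷ K) (true ∷ L) h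
  with e₁ , e₂ ← admissible⇒excess I J K L h =
  ≡.trans (ℕ.+-suc _ _) (cong suc e₁) , ≡.trans (ℕ.+-suc _ _) (cong suc e₂)
admissible⇒excess (false ∷ I) (false ∷ J) (false ∷ K) (true ∷ L) ()
admissible⇒excess (false ∷ I) (false ∷ J) (true ∷ K) (false ∷ L) ()
admissible⇒excess (false ∷ I) (false ∷ J) (true ∷ K) (true ∷ L) ()
admissible⇒excess (false ∷ I) (true ∷ J) (false ∷ K) (false ∷ L) ()
admissible⇒excess (false ∷ I) (true ∷ J) (false ∷ K) (true ∷ L) ()
admissible⇒excess (false ∷ I) (true ∷ J) (true ∷ K) (true ∷ L) ()
admissible⇒excess (true ∷ I) (false ∷ J) (false ∷ K) (false ∷ L) ()
admissible⇒excess (true ∷ I) (false ∷ J) (true ∷ K) (true ∷ L) ()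
admissible⇒excess (true ∷ I) (true ∷ J) (false ∷ K) (false ∷ L) ()
admissible⇒excess (true ∷ I) (true ∷ J) (false ∷ K) (true ∷ L) ()
admissible⇒excess (true ∷ I) (true ∷ J) (true ∷ K) (false ∷ L) ()

m+n≡o⇒m≡o∸n : ∀ m n o → m +ℕ n ≡ o → m ≡ o ∸ n
m+n≡o⇒m≡o∸n m n o e = ≡.trans (≡.sym (ℕ.m+n∸n≡m m n)) (cong (_∸ n) e)

excess≡∣K∣∸∣J∣ : {k : ℕ} (I J K L : Vec Bool k) → admissible I J K L ≡ true → excess K J ≡ ∣ K ∣ ∸ ∣ J ∣
excess≡∣K∣∸∣J∣ I J K L adm = m+n≡o⇒m≡o∸n _ _ _ (proj₁ (admissible⇒excess I J K L adm))

excess≡∣I∣∸∣L∣ : {k : ℕ} (I J K L : Vec Bool k) → admissible I J K L ≡ true → excess K J ≡ ∣ I ∣ ∸ ∣ L ∣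
excess≡∣I∣∸∣L∣ I J K L adm = m+n≡o⇒m≡o∸n _ _ _ (proj₂ (admissible⇒excess I J K L adm))

+-telescope : ∀ d₁ d₂ j a k → d₁ +ℕ a ≡ k → d₂ +ℕ j ≡ a → d₁ +ℕ d₂ ≡ k ∸ j
+-telescope d₁ d₂ j a k e₁ e₂ =
  m+n≡o⇒m≡o∸n (d₁ +ℕ d₂) j k (≡.trans (ℕ.+-assoc d₁ d₂ j) (≡.trans (cong (d₁ +ℕ_) e₂) e₁))

bools : List Bool
bools = false ∷ true ∷ []

triples : List (Bool × Bool × Bool)
triples = concatMap (λ a → concatMap (λ b → map (λ c → a , b , c) bools) bools) bools

module Proof {c ℓ : Level} (R : CommutativeRing c ℓ) where
  open CommutativeRing R
  open Weights R
  open import Algebra.Properties.CommutativeSemigroup *-commutativeSemigroup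
    using (interchange; x∙yz≈y∙xz; xy∙z≈zy∙x)
  open import Algebra.Properties.CommutativeSemigroup +-commutativeSemigroup
    using () renaming (interchange to +-interchange)
  open import Algebra.Properties.AbelianGroup +-abelianGroup using (xyx⁻¹≈y)
  open import Relation.Binary.Reasoning.Setoid setoid
  open NatCoefficients commutativeSemiring using (solve; _:=_; _:+_; _:*_)

  pow-+ : ∀ a m n → pow a (m +ℕ n) ≈ pow a m * pow a n
  pow-+ a zero n = sym (*-identityˡ _)
  pow-+ a (suc m) n = trans (*-congˡ (pow-+ a m n)) (sym (*-assoc _ _ _))

  sumL-cong : {A : Set} (xs : List A) {f g : A → Carrier} → (∀ a → f a ≈ g a) → sumL xs f ≈ sumL xs g
  sumL-cong [] _ = refl
  sumL-cong (a ∷ xs) f≈g = +-cong (f≈g a) (sumL-cong xs f≈g)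

  sumL-0 : {A : Set} (xs : List A) → sumL xs (λ _ → 0#) ≈ 0#
  sumL-0 [] = refl
  sumL-0 (_ ∷ xs) = trans (+-identityˡ _) (sumL-0 xs)

  sumL-+ : {A : Set} (xs : List A) (f g : A → Carrier) → sumL xs (λ a → f a + g a) ≈ sumL xs f + sumL xs g
  sumL-+ [] f g = sym (+-identityˡ 0#)
  sumL-+ (a ∷ xs) f g = begin
    (f a + g a) + sumL xs (λ a → f a + g a) ≈⟨ +-congˡ (sumL-+ xs f g) ⟩
    (f a + g a) + (sumL xs f + sumL xs g)   ≈⟨ +-interchange _ _ _ _ ⟩
    (f a + sumL xs f) + (g a + sumL xs g)   ∎

  sumL-*ˡ : {A : Set} (xs : List A) (b : Carrier) (f : A → Carrier) → sumL xs (λ a → b * f a) ≈ b * sumL xs f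
  sumL-*ˡ [] b f = sym (zeroʳ b)
  sumL-*ˡ (a ∷ xs) b f = trans (+-congˡ (sumL-*ˡ xs b f)) (sym (distribˡ b _ _))

  sumL-++ : {A : Set} (xs ys : List A) (f : A → Carrier) → sumL (xs ++ ys) f ≈ sumL xs f + sumL ys f
  sumL-++ [] ys f = sym (+-identityˡ _)
  sumL-++ (a ∷ xs) ys f = trans (+-congˡ (sumL-++ xs ys f)) (sym (+-assoc _ _ _))

  sumL-swap : {A B : Set} (xs : List A) (ys : List B) (h : A → B → Carrier) →
              sumL xs (λ a → sumL ys (h a)) ≈ sumL ys (λ b → sumL xs (λ a → h a b))
  sumL-swap [] ys h = sym (sumL-0 ys)
  sumL-swap (a ∷ xs) ys h =
    trans (+-congˡ (sumL-swap xs ys h)) (sym (sumL-+ ys (h a) (λ b → sumL xs (λ a → h a b))))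

  sumL-map : {A B : Set} (g : A → B) (xs : List A) (f : B → Carrier) → sumL (map g xs) f ≡ sumL xs (f ∘ g)
  sumL-map g [] f = ≡.refl
  sumL-map g (a ∷ xs) f = cong (f (g a) +_) (sumL-map g xs f)

  sumL-concatMap : {A B : Set} (g : A → List B) (xs : List A) (f : B → Carrier) →
                   sumL (concatMap g xs) f ≈ sumL xs (λ a → sumL (g a) f)
  sumL-concatMap g [] f = refl
  sumL-concatMap g (a ∷ xs) f = trans (sumL-++ (g a) _ f) (+-congˡ (sumL-concatMap g xs f))

  sumL-triples : (f : Bool × Bool × Bool → Carrier) →
    sumL triples f ≈ sumL bools (λ a → sumL bools (λ b → sumL bools (λ c → f (a , b , c))))
  sumL-triples f =
    trans (sumL-concatMap (λ a → concatMap (λ b → map (λ c → a , b , c) bools) bools) bools f)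
      (sumL-cong bools (λ a →
        trans (sumL-concatMap (λ b → map (λ c → a , b , c) bools) bools f)
          (sumL-cong bools (λ b → reflexive (sumL-map (λ c → a , b , c) bools f)))))

  Σ𝟚-cong : ∀ k {f g : Vec Bool k → Carrier} → (∀ A → f A ≈ g A) → Σ𝟚 k f ≈ Σ𝟚 k g
  Σ𝟚-cong k = sumL-cong (allVecs k)

  Σ𝟚-∷ : ∀ k (f : Vec Bool (suc k) → Carrier) → Σ𝟚 (suc k) f ≈ sumL bools (λ a → Σ𝟚 k (f ∘ (a ∷_)))
  Σ𝟚-∷ k f = begin
    sumL (map (false ∷_) (allVecs k) ++ map (true ∷_) (allVecs k)) f
      ≈⟨ sumL-++ (map (false ∷_) (allVecs k)) _ f ⟩
    sumL (map (false ∷_) (allVecs k)) f + sumL (map (true ∷_) (allVecs k)) f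
      ≈⟨ +-cong (reflexive (sumL-map (false ∷_) (allVecs k) f))
                (trans (reflexive (sumL-map (true ∷_) (allVecs k) f)) (sym (+-identityʳ _))) ⟩
    Σ𝟚 k (f ∘ (false ∷_)) + (Σ𝟚 k (f ∘ (true ∷_)) + 0#) ∎

  Σ³ : ∀ k → (Vec Bool k → Vec Bool k → Vec Bool k → Carrier) → Carrier
  Σ³ k f = Σ𝟚 k (λ A → Σ𝟚 k (λ B → Σ𝟚 k (λ C → f A B C)))

  Σ³-cong : ∀ k {f g : Vec Bool k → Vec Bool k → Vec Bool k → Carrier} →
            (∀ A B C → f A B C ≈ g A B C) → Σ³ k f ≈ Σ³ k g
  Σ³-cong k f≈g = Σ𝟚-cong k (λ A → Σ𝟚-cong k (λ B → Σ𝟚-cong k (λ C → f≈g A B C)))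

  Σ³-*ˡ : ∀ k a (f : Vec Bool k → Vec Bool k → Vec Bool k → Carrier) →
          Σ³ k (λ A B C → a * f A B C) ≈ a * Σ³ k f
  Σ³-*ˡ k a f =
    trans (Σ𝟚-cong k (λ A → trans (Σ𝟚-cong k (λ B → sumL-*ˡ (allVecs k) a (f A B)))
                                   (sumL-*ˡ (allVecs k) a _)))
          (sumL-*ˡ (allVecs k) a _)

  Σ³-+ : ∀ k (f g : Vec Bool k → Vec Bool k → Vec Bool k → Carrier) →
         Σ³ k (λ A B C → f A B C + g A B C) ≈ Σ³ k f + Σ³ k g
  Σ³-+ k f g =
    trans (Σ𝟚-cong k (λ A → trans (Σ𝟚-cong k (λ B → sumL-+ (allVecs k) (f A B) (g A B)))
                                   (sumL-+ (allVecs k) _ _)))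
          (sumL-+ (allVecs k) _ _)

  Σ³-combine : ∀ k a (f g h : Vec Bool k → Vec Bool k → Vec Bool k → Carrier) →
    (∀ A B C → a * f A B C + g A B C ≈ h A B C) → a * Σ³ k f + Σ³ k g ≈ Σ³ k h
  Σ³-combine k a f g h termwise =
    trans (+-congʳ (sym (Σ³-*ˡ k a f))) (trans (sym (Σ³-+ k _ g)) (Σ³-cong k termwise))

  Σ³-[] : (f : Vec Bool 0 → Vec Bool 0 → Vec Bool 0 → Carrier) → Σ³ 0 f ≈ f [] [] []
  Σ³-[] f = trans (+-identityʳ _) (trans (+-identityʳ _) (+-identityʳ _))

  Σ³-∷ : ∀ k (f : Vec Bool (suc k) → Vec Bool (suc k) → Vec Bool (suc k) → Carrier) →
    Σ³ (suc k) f ≈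
    sumL bools (λ a → sumL bools (λ b → sumL bools (λ c →
      Σ³ k (λ A B C → f (a ∷ A) (b ∷ B) (c ∷ C)))))
  Σ³-∷ k f = begin
    Σ³ (suc k) f
      ≈⟨ Σ𝟚-cong (suc k) (λ A → Σ𝟚-cong (suc k) (λ B → Σ𝟚-∷ k (f A B))) ⟩
    Σ𝟚 (suc k) (λ A → Σ𝟚 (suc k) (λ B → sumL bools (λ c → Σ𝟚 k (λ C → f A B (c ∷ C)))))
      ≈⟨ Σ𝟚-cong (suc k) (λ A → Σ𝟚-∷ k _) ⟩
    Σ𝟚 (suc k) (λ A → sumL bools (λ b → Σ𝟚 k (λ B → sumL bools (λ c →
      Σ𝟚 k (λ C → f A (b ∷ B) (c ∷ C))))))
      ≈⟨ Σ𝟚-cong (suc k) (λ A → sumL-cong bools (λ b →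
           sumL-swap (allVecs k) bools (λ B c → Σ𝟚 k (λ C → f A (b ∷ B) (c ∷ C))))) ⟩
    Σ𝟚 (suc k) (λ A → sumL bools (λ b → sumL bools (λ c →
      Σ𝟚 k (λ B → Σ𝟚 k (λ C → f A (b ∷ B) (c ∷ C))))))
      ≈⟨ Σ𝟚-∷ k _ ⟩
    sumL bools (λ a → Σ𝟚 k (λ A → sumL bools (λ b → sumL bools (λ c →
      Σ𝟚 k (λ B → Σ𝟚 k (λ C → f (a ∷ A) (b ∷ B) (c ∷ C)))))))
      ≈⟨ sumL-cong bools (λ a →
           trans (sumL-swap (allVecs k) bools (λ A b → sumL bools (λ c →
                    Σ𝟚 k (λ B → Σ𝟚 k (λ C → f (a ∷ A) (b ∷ B) (c ∷ C))))))
                 (sumL-cong bools (λ b → sumL-swap (allVecs k) bools (λ A c →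
                    Σ𝟚 k (λ B → Σ𝟚 k (λ C → f (a ∷ A) (b ∷ B) (c ∷ C))))))) ⟩
    sumL bools (λ a → sumL bools (λ b → sumL bools (λ c →
      Σ³ k (λ A B C → f (a ∷ A) (b ∷ B) (c ∷ C))))) ∎

  -- Ring elements with 0 and 1 kept symbolic: for concrete boundary bits, products of
  -- site factors and sums Σᶠ of nonzero terms compute to clean ring expressions, so each
  -- case of site-identity can be stated as the literal identity it reduces to.
  data Factor : Set c where
    𝟘 𝟙 : Factor
    ⟨_⟩ : Carrier → Factor

  ⟦_⟧ : Factor → Carrier
  ⟦ 𝟘 ⟧ = 0#
  ⟦ 𝟙 ⟧ = 1#
  ⟦ ⟨ a ⟩ ⟧ = a

  infixl 7 _⊛_
  _⊛_ : Factor → Factor → Factor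
  𝟘 ⊛ g = 𝟘
  𝟙 ⊛ g = g
  ⟨ a ⟩ ⊛ 𝟘 = 𝟘
  ⟨ a ⟩ ⊛ 𝟙 = ⟨ a ⟩
  ⟨ a ⟩ ⊛ ⟨ b ⟩ = ⟨ a * b ⟩

  infixr 7 _·_
  _·_ : Factor → Carrier → Carrier
  𝟘 · X = 0#
  𝟙 · X = X
  ⟨ a ⟩ · X = a * X

  ·≈⟦⟧* : ∀ f X → f · X ≈ ⟦ f ⟧ * X
  ·≈⟦⟧* 𝟘 X = sym (zeroˡ X)
  ·≈⟦⟧* 𝟙 X = sym (*-identityˡ X)
  ·≈⟦⟧* ⟨ a ⟩ X = refl

  ⟦⊛⟧ : ∀ f g → ⟦ f ⊛ g ⟧ ≈ ⟦ f ⟧ * ⟦ g ⟧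
  ⟦⊛⟧ 𝟘 g = sym (zeroˡ _)
  ⟦⊛⟧ 𝟙 g = sym (*-identityˡ _)
  ⟦⊛⟧ ⟨ a ⟩ 𝟘 = sym (zeroʳ a)
  ⟦⊛⟧ ⟨ a ⟩ 𝟙 = sym (*-identityʳ a)
  ⟦⊛⟧ ⟨ a ⟩ ⟨ b ⟩ = refl

  ·-*-· : ∀ f g X Y → (f · X) * (g · Y) ≈ (f ⊛ g) · (X * Y)
  ·-*-· f g X Y = begin
    (f · X) * (g · Y)         ≈⟨ *-cong (·≈⟦⟧* f X) (·≈⟦⟧* g Y) ⟩
    (⟦ f ⟧ * X) * (⟦ g ⟧ * Y) ≈⟨ interchange _ _ _ _ ⟩
    (⟦ f ⟧ * ⟦ g ⟧) * (X * Y) ≈⟨ *-congʳ (⟦⊛⟧ f g) ⟨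
    ⟦ f ⊛ g ⟧ * (X * Y)       ≈⟨ ·≈⟦⟧* (f ⊛ g) (X * Y) ⟨
    (f ⊛ g) · (X * Y)         ∎

  ·-*-·-*-· : ∀ f g h X Y Z → ((f · X) * (g · Y)) * (h · Z) ≈ (f ⊛ g ⊛ h) · ((X * Y) * Z)
  ·-*-·-*-· f g h X Y Z = trans (*-congʳ (·-*-· f g X Y)) (·-*-· (f ⊛ g) h (X * Y) Z)

  Σ³-· : ∀ k f (g : Vec Bool k → Vec Bool k → Vec Bool k → Carrier) →
         Σ³ k (λ A B C → f · g A B C) ≈ f · Σ³ k g
  Σ³-· k f g = begin
    Σ³ k (λ A B C → f · g A B C)      ≈⟨ Σ³-cong k (λ A B C → ·≈⟦⟧* f (g A B C)) ⟩
    Σ³ k (λ A B C → ⟦ f ⟧ * g A B C)  ≈⟨ Σ³-*ˡ k ⟦ f ⟧ g ⟩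
    ⟦ f ⟧ * Σ³ k g                    ≈⟨ ·≈⟦⟧* f (Σ³ k g) ⟨
    f · Σ³ k g                        ∎

  nonzero : List (Factor × Carrier) → List (Factor × Carrier)
  nonzero [] = []
  nonzero ((𝟘 , X) ∷ ts) = nonzero ts
  nonzero (t ∷ ts) = t ∷ nonzero ts

  Σᶠ : List (Factor × Carrier) → Carrier
  Σᶠ [] = 0#
  Σᶠ ((f , X) ∷ []) = f · X
  Σᶠ ((f , X) ∷ ts@(_ ∷ _)) = f · X + Σᶠ ts

  Σᶠ-∷ : ∀ f X ts → Σᶠ ((f , X) ∷ ts) ≈ f · X + Σᶠ ts
  Σᶠ-∷ f X [] = sym (+-identityʳ _)
  Σᶠ-∷ f X (_ ∷ _) = refl

  Σᶠ-nonzero-∷ : ∀ t ts → Σᶠ (nonzero (t ∷ ts)) ≈ uncurry _·_ t + Σᶠ (nonzero ts)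
  Σᶠ-nonzero-∷ (𝟘 , X) ts = sym (+-identityˡ _)
  Σᶠ-nonzero-∷ (𝟙 , X) ts = Σᶠ-∷ 𝟙 X (nonzero ts)
  Σᶠ-nonzero-∷ (⟨ a ⟩ , X) ts = Σᶠ-∷ ⟨ a ⟩ X (nonzero ts)

  Σᶠ-nonzero : {A : Set} (xs : List A) (h : A → Factor × Carrier) →
               Σᶠ (nonzero (map h xs)) ≈ sumL xs (λ a → uncurry _·_ (h a))
  Σᶠ-nonzero [] h = refl
  Σᶠ-nonzero (a ∷ xs) h = trans (Σᶠ-nonzero-∷ (h a) (map h xs)) (+-congˡ (Σᶠ-nonzero xs h))

  if-shift : ∀ b {a X Y Z} → a * X + Y ≈ Z →
    a * (if b then X else 0#) + (if b then Y else 0#) ≈ (if b then Z else 0#)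
  if-shift true aX+Y≈Z = aX+Y≈Z
  if-shift false _ = trans (+-identityʳ _) (zeroʳ _)

  if-cong : ∀ b {X Y} → (b ≡ true → X ≈ Y) → (if b then X else 0#) ≈ (if b then Y else 0#)
  if-cong true X≈Y = X≈Y ≡.refl
  if-cong false _ = refl

  if-*ˡ : ∀ b {a X Y} → X ≈ a * Y → (if b then X else 0#) ≈ a * (if b then Y else 0#)
  if-*ˡ true X≈aY = X≈aY
  if-*ˡ false _ = sym (zeroʳ _)

  *-if : ∀ b {a a′ X} → (b ≡ true → a ≈ a′) → a * (if b then X else 0#) ≈ a′ * (if b then X else 0#)
  *-if true a≈a′ = *-congʳ (a≈a′ ≡.refl)
  *-if false _ = trans (zeroʳ _) (sym (zeroʳ _))

  *-if-if : ∀ b₁ b₂ {a a′ X Y Z} → (b₁ ≡ true → b₂ ≡ true → a ≈ a′) →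
    a * (((if b₁ then X else 0#) * Y) * (if b₂ then Z else 0#)) ≈
    a′ * (((if b₁ then X else 0#) * Y) * (if b₂ then Z else 0#))
  *-if-if true b₂ a≈a′ =
    trans (x∙yz≈y∙xz _ _ _) (trans (*-congˡ (*-if b₂ (a≈a′ ≡.refl))) (x∙yz≈y∙xz _ _ _))
  *-if-if false b₂ _ = trans vanishes (sym vanishes)
    where
    vanishes : ∀ {a Y W} → a * ((0# * Y) * W) ≈ 0#
    vanishes = trans (*-congˡ (trans (*-congʳ (zeroˡ _)) (zeroˡ _))) (zeroʳ _)

  module _ (t : Carrier) where

    -- R'' u t = weight (poch u t) 0 u 0 and P z t = weight (λ _ → 1#) 0 z 0.
    weight : {n : ℕ} → (ℕ → Carrier) → ℕ → Carrier → ℕ → (I J K L : Vec Bool n) → Carrier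
    weight f m z s I J K L =
      if admissible I J K L
      then (pow z ∣ L ∣ * f (m +ℕ excess K J)) * pow t (s *ℕ excess K J +ℕ φ L (diff K J))
      else 0#

    -- The first-coordinate factor z^l τ^(k − j) of a weight, τ standing for t^s.
    site : Carrier → Factor → Bool → Bool → Bool → Bool → Factor
    site z τ false false false false = 𝟙
    site z τ false true  true  false = 𝟙
    site z τ true  false false true  = ⟨ z ⟩
    site z τ true  false true  false = τ
    site z τ true  true  true  true  = ⟨ z ⟩
    site z τ _     _     _     _     = 𝟘

    peel-label : ∀ z Z W s D e →
      ((z * Z) * W) * pow t (s *ℕ D +ℕ (1 *ℕ D +ℕ e)) ≈ z * ((Z * W) * pow t (suc s *ℕ D +ℕ e))
    peel-label z Z W s D e =
      trans (*-cong (*-assoc z Z W) (reflexive (cong (pow t) (exponent s D e)))) (*-assoc z (Z * W) _)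
      where
      exponent : ∀ s D e → s *ℕ D +ℕ (1 *ℕ D +ℕ e) ≡ suc s *ℕ D +ℕ e
      exponent = solve-∀

    peel-excess : ∀ τ {s} → ⟦ τ ⟧ ≈ pow t s → ∀ Z (f : ℕ → Carrier) m D e →
      (Z * f (m +ℕ suc D)) * pow t (s *ℕ suc D +ℕ e) ≈ ⟦ τ ⟧ * ((Z * f (suc (m +ℕ D))) * pow t (s *ℕ D +ℕ e))
    peel-excess τ {s} τ≈tˢ Z f m D e = begin
      (Z * f (m +ℕ suc D)) * pow t (s *ℕ suc D +ℕ e)
        ≈⟨ *-cong (*-congˡ (reflexive (cong f (ℕ.+-suc m D))))
                  (trans (reflexive (cong (pow t) (exponent s D e))) (pow-+ t s _)) ⟩
      (Z * f (suc (m +ℕ D))) * (pow t s * pow t (s *ℕ D +ℕ e))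
        ≈⟨ x∙yz≈y∙xz _ _ _ ⟩
      pow t s * ((Z * f (suc (m +ℕ D))) * pow t (s *ℕ D +ℕ e))
        ≈⟨ *-congʳ τ≈tˢ ⟨
      ⟦ τ ⟧ * ((Z * f (suc (m +ℕ D))) * pow t (s *ℕ D +ℕ e)) ∎
      where
      exponent : ∀ s D e → s *ℕ suc D +ℕ e ≡ s +ℕ (s *ℕ D +ℕ e)
      exponent = solve-∀

    weight-∷ : ∀ {n} f m z s τ → ⟦ τ ⟧ ≈ pow t s → ∀ i j k l (I J K L : Vec Bool n) →
      weight f m z s (i ∷ I) (j ∷ J) (k ∷ K) (l ∷ L) ≈
      site z τ i j k l · weight f ((b2n k ∸ b2n j) +ℕ m) z (b2n l +ℕ s) I J K L
    weight-∷ f m z s τ τ≈tˢ false false false false I J K L = refl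
    weight-∷ f m z s τ τ≈tˢ false true  true  false I J K L = refl
    weight-∷ f m z s τ τ≈tˢ true  false false true  I J K L =
      if-*ˡ (admissible I J K L) (peel-label z _ _ s (excess K J) _)
    weight-∷ f m z s τ τ≈tˢ true  true  true  true  I J K L =
      if-*ˡ (admissible I J K L) (peel-label z _ _ s (excess K J) _)
    weight-∷ f m z s τ τ≈tˢ true  false true  false I J K L =
      trans (if-*ˡ (admissible I J K L) (peel-excess τ {s} τ≈tˢ _ f m (excess K J) (φ L (diff K J))))
            (sym (·≈⟦⟧* τ _))
    weight-∷ f m z s τ τ≈tˢ false false false true  I J K L = refl
    weight-∷ f m z s τ τ≈tˢ false false true  false I J K L = refl
    weight-∷ f m z s τ τ≈tˢ false false true  true  I J K L = refl
    weight-∷ f m z s τ τ≈tˢ false true  false false I J K L = refl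
    weight-∷ f m z s τ τ≈tˢ false true  false true  I J K L = refl
    weight-∷ f m z s τ τ≈tˢ false true  true  true  I J K L = refl
    weight-∷ f m z s τ τ≈tˢ true  false false false I J K L = refl
    weight-∷ f m z s τ τ≈tˢ true  false true  true  I J K L = refl
    weight-∷ f m z s τ τ≈tˢ true  true  false false I J K L = refl
    weight-∷ f m z s τ τ≈tˢ true  true  false true  I J K L = refl
    weight-∷ f m z s τ τ≈tˢ true  true  true  false I J K L = refl

    weight-twist : ∀ {n} f m z s (I J K L : Vec Bool n) →
      weight f m z (suc s) I J K L ≈ pow t (excess K J) * weight f m z s I J K L
    weight-twist f m z s I J K L = if-*ˡ (admissible I J K L)
      (trans (*-congˡ (trans (reflexive (cong (pow t) (ℕ.+-assoc (excess K J) _ _))) (pow-+ t (excess K J) _)))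
             (x∙yz≈y∙xz _ _ _))

    weight-twistᴷ : ∀ {n} f m z s (I J K L : Vec Bool n) →
      weight f m z (suc s) I J K L ≈ pow t (∣ K ∣ ∸ ∣ J ∣) * weight f m z s I J K L
    weight-twistᴷ f m z s I J K L = trans (weight-twist f m z s I J K L)
      (*-if (admissible I J K L) (λ adm → reflexive (cong (pow t) (excess≡∣K∣∸∣J∣ I J K L adm))))

    weight-twistᴵ : ∀ {n} f m z s (I J K L : Vec Bool n) →
      weight f m z (suc s) I J K L ≈ pow t (∣ I ∣ ∸ ∣ L ∣) * weight f m z s I J K L
    weight-twistᴵ f m z s I J K L = trans (weight-twist f m z s I J K L)
      (*-if (admissible I J K L) (λ adm → reflexive (cong (pow t) (excess≡∣I∣∸∣L∣ I J K L adm))))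

    weight-twist₂ : ∀ {n} f₁ m₁ z₁ s₁ (I₁ J₁ K₁ L₁ : Vec Bool n) X f₂ m₂ z₂ s₂ (I₂ J₂ K₂ L₂ : Vec Bool n) e →
      (admissible I₁ J₁ K₁ L₁ ≡ true → admissible I₂ J₂ K₂ L₂ ≡ true → excess K₁ J₁ +ℕ excess K₂ J₂ ≡ e) →
      (weight f₁ m₁ z₁ (suc s₁) I₁ J₁ K₁ L₁ * X) * weight f₂ m₂ z₂ (suc s₂) I₂ J₂ K₂ L₂ ≈
      pow t e * ((weight f₁ m₁ z₁ s₁ I₁ J₁ K₁ L₁ * X) * weight f₂ m₂ z₂ s₂ I₂ J₂ K₂ L₂)
    weight-twist₂ f₁ m₁ z₁ s₁ I₁ J₁ K₁ L₁ X f₂ m₂ z₂ s₂ I₂ J₂ K₂ L₂ e excesses = begin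
      (weight f₁ m₁ z₁ (suc s₁) I₁ J₁ K₁ L₁ * X) * weight f₂ m₂ z₂ (suc s₂) I₂ J₂ K₂ L₂
        ≈⟨ *-cong (*-congʳ (weight-twist f₁ m₁ z₁ s₁ I₁ J₁ K₁ L₁)) (weight-twist f₂ m₂ z₂ s₂ I₂ J₂ K₂ L₂) ⟩
      ((pow t d₁ * W₁) * X) * (pow t d₂ * W₂)   ≈⟨ pull-ends _ _ _ _ _ ⟩
      (pow t d₁ * pow t d₂) * ((W₁ * X) * W₂)   ≈⟨ *-congʳ (pow-+ t d₁ d₂) ⟨
      pow t (d₁ +ℕ d₂) * ((W₁ * X) * W₂)
        ≈⟨ *-if-if (admissible I₁ J₁ K₁ L₁) (admissible I₂ J₂ K₂ L₂)
                   (λ adm₁ adm₂ → reflexive (cong (pow t) (excesses adm₁ adm₂))) ⟩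
      pow t e * ((W₁ * X) * W₂)                 ∎
      where
      d₁ d₂ : ℕ
      d₁ = excess K₁ J₁
      d₂ = excess K₂ J₂
      W₁ W₂ : Carrier
      W₁ = weight f₁ m₁ z₁ s₁ I₁ J₁ K₁ L₁
      W₂ = weight f₂ m₂ z₂ s₂ I₂ J₂ K₂ L₂
      pull-ends : ∀ a b c d e → ((a * b) * c) * (d * e) ≈ (a * d) * ((b * c) * e)
      pull-ends = solve 5 (λ a b c d e → ((a :* b) :* c) :* (d :* e) := (a :* d) :* ((b :* c) :* e)) refl

    box : {n : ℕ} → Carrier → ℕ → (I J K L : Vec Bool n) → Carrier
    box z s = weight (λ _ → 1#) 0 z s

    P≈box : ∀ {n} z (I J K L : Vec Bool n) → P z t I J K L ≈ box z 0 I J K L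
    P≈box z I J K L = if-cong (admissible I J K L) (λ _ → *-congʳ (sym (*-identityʳ _)))

    module _ (u : Carrier) where

      cross : {n : ℕ} → ℕ → ℕ → (I J K L : Vec Bool n) → Carrier
      cross m s = weight (poch u t) m u s

      R''≈cross : ∀ {n} (I J K L : Vec Bool n) → R'' u t I J K L ≈ cross 0 0 I J K L
      R''≈cross I J K L = if-cong (admissible I J K L) (λ adm →
        *-congʳ (*-congˡ (reflexive (cong (poch u t) (≡.sym (excess≡∣K∣∸∣J∣ I J K L adm))))))

      poch-shift : ∀ U m D e →
        (u * pow t m) * ((U * poch u t (m +ℕ D)) * pow t (1 *ℕ D +ℕ e)) +
          (U * poch u t (suc (m +ℕ D))) * pow t e
        ≈ (U * poch u t (m +ℕ D)) * pow t e
      poch-shift U m D e = begin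
        (u * pow t m) * ((U * Pc) * pow t (1 *ℕ D +ℕ e)) + (U * (Pc * (1# - u * pow t (m +ℕ D)))) * pow t e
          ≈⟨ +-cong (*-congˡ (*-congˡ (trans (reflexive (cong (λ n → pow t (n +ℕ e)) (ℕ.*-identityˡ D)))
                                             (pow-+ t D e))))
                    (*-congʳ (*-congˡ (*-congˡ (+-congˡ (-‿cong (*-congˡ (pow-+ t m D))))))) ⟩
        (u * pow t m) * ((U * Pc) * (pow t D * pow t e)) + (U * (Pc * (1# - w))) * pow t e
          ≈⟨ solve 7 (λ u′ tᵐ tᴰ tᵉ U′ P′ V →
                (u′ :* tᵐ) :* ((U′ :* P′) :* (tᴰ :* tᵉ)) :+ (U′ :* (P′ :* V)) :* tᵉ
                := ((U′ :* P′) :* tᵉ) :* (u′ :* (tᵐ :* tᴰ)) :+ ((U′ :* P′) :* tᵉ) :* V)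
                refl u (pow t m) (pow t D) (pow t e) U Pc (1# - w) ⟩
        Q * w + Q * (1# - w)  ≈⟨ distribˡ Q w (1# - w) ⟨
        Q * (w + (1# - w))    ≈⟨ *-congˡ (trans (sym (+-assoc w 1# (- w))) (xyx⁻¹≈y w 1#)) ⟩
        Q * 1#                ≈⟨ *-identityʳ Q ⟩
        Q                     ∎
        where
        Pc w Q : Carrier
        Pc = poch u t (m +ℕ D)
        w = u * (pow t m * pow t D)
        Q = (U * Pc) * pow t e

      cross-shift : ∀ {n} m (I J K L : Vec Bool n) →
        (u * pow t m) * cross m 1 I J K L + cross (suc m) 0 I J K L ≈ cross m 0 I J K L
      cross-shift m I J K L =
        if-shift (admissible I J K L) (poch-shift (pow u ∣ L ∣) m (excess K J) (φ L (diff K J)))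

      module _ (x y : Carrier) where

        lhs : ∀ k (m r s q : ℕ) (I₁ J₁ K₁ I₃ J₃ K₃ : Vec Bool k) → Carrier
        lhs k m r s q I₁ J₁ K₁ I₃ J₃ K₃ =
          Σ³ k (λ A B C → (cross m r I₁ J₁ A B * box x s K₁ B C J₃) * box y q C A K₃ I₃)

        rhs : ∀ k (m r s q : ℕ) (I₁ J₁ K₁ I₃ J₃ K₃ : Vec Bool k) → Carrier
        rhs k m r s q I₁ J₁ K₁ I₃ J₃ K₃ =
          Σ³ k (λ A B C → (box y q K₁ I₁ C A * box x s C J₁ K₃ B) * cross m r A B I₃ J₃)

        module _ {k : ℕ} (I₁ J₁ K₁ I₃ J₃ K₃ : Vec Bool k) where

          private
            pull-middle : ∀ a b c d → (a * (c * b)) * d ≈ c * ((a * b) * d)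
            pull-middle a b c d = trans (*-congʳ (x∙yz≈y∙xz a c b)) (*-assoc c (a * b) d)

          lhs-twistˣ : ∀ m r s q → lhs k m r (suc s) q I₁ J₁ K₁ I₃ J₃ K₃ ≈
                                   pow t (∣ K₁ ∣ ∸ ∣ J₃ ∣) * lhs k m r s q I₁ J₁ K₁ I₃ J₃ K₃
          lhs-twistˣ m r s q = trans (Σ³-cong k (λ A B C →
              trans (*-congʳ (*-congˡ (weight-twistᴵ _ 0 x s K₁ B C J₃))) (pull-middle _ _ _ _)))
            (Σ³-*ˡ k _ _)

          rhs-twistˣ : ∀ m r s q → rhs k m r (suc s) q I₁ J₁ K₁ I₃ J₃ K₃ ≈
                                   pow t (∣ K₃ ∣ ∸ ∣ J₁ ∣) * rhs k m r s q I₁ J₁ K₁ I₃ J₃ K₃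
          rhs-twistˣ m r s q = trans (Σ³-cong k (λ A B C →
              trans (*-congʳ (*-congˡ (weight-twistᴷ _ 0 x s C J₁ K₃ B))) (pull-middle _ _ _ _)))
            (Σ³-*ˡ k _ _)

          lhs-twistʸ : ∀ m r s q → lhs k m (suc r) s (suc q) I₁ J₁ K₁ I₃ J₃ K₃ ≈
                                   pow t (∣ K₃ ∣ ∸ ∣ J₁ ∣) * lhs k m r s q I₁ J₁ K₁ I₃ J₃ K₃
          lhs-twistʸ m r s q = trans (Σ³-cong k (λ A B C →
              weight-twist₂ (poch u t) m u r I₁ J₁ A B (box x s K₁ B C J₃) (λ _ → 1#) 0 y q C A K₃ I₃
                            (∣ K₃ ∣ ∸ ∣ J₁ ∣) (λ adm₁ adm₂ →
                ≡.trans (ℕ.+-comm (excess A J₁) _)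
                  (+-telescope _ _ (∣ J₁ ∣) (∣ A ∣) (∣ K₃ ∣) (proj₁ (admissible⇒excess C A K₃ I₃ adm₂))
                                                             (proj₁ (admissible⇒excess I₁ J₁ A B adm₁))))))
            (Σ³-*ˡ k _ _)

          rhs-twistʸ : ∀ m r s q → rhs k m (suc r) s (suc q) I₁ J₁ K₁ I₃ J₃ K₃ ≈
                                   pow t (∣ K₁ ∣ ∸ ∣ J₃ ∣) * rhs k m r s q I₁ J₁ K₁ I₃ J₃ K₃
          rhs-twistʸ m r s q = trans (Σ³-cong k (λ A B C →
              weight-twist₂ (λ _ → 1#) 0 y q K₁ I₁ C A (box x s C J₁ K₃ B) (poch u t) m u r A B I₃ J₃
                            (∣ K₁ ∣ ∸ ∣ J₃ ∣) (λ adm₁ adm₂ →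
                +-telescope _ _ (∣ J₃ ∣) (∣ A ∣) (∣ K₁ ∣) (proj₂ (admissible⇒excess K₁ I₁ C A adm₁))
                                                          (proj₂ (admissible⇒excess A B I₃ J₃ adm₂)))))
            (Σ³-*ˡ k _ _)

          lhs-shift : ∀ m s q →
            (u * pow t m) * lhs k m 1 s q I₁ J₁ K₁ I₃ J₃ K₃ + lhs k (suc m) 0 s q I₁ J₁ K₁ I₃ J₃ K₃ ≈
            lhs k m 0 s q I₁ J₁ K₁ I₃ J₃ K₃
          lhs-shift m s q = Σ³-combine k _ _ _ _ (λ A B C →
            trans (factor-out _ _ _ _ _) (*-congʳ (*-congʳ (cross-shift m I₁ J₁ A B))))
            where
            factor-out : ∀ a X₁ X₀ Y Z → a * ((X₁ * Y) * Z) + (X₀ * Y) * Z ≈ ((a * X₁ + X₀) * Y) * Z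
            factor-out = solve 5 (λ a X₁ X₀ Y Z →
              a :* ((X₁ :* Y) :* Z) :+ (X₀ :* Y) :* Z := ((a :* X₁ :+ X₀) :* Y) :* Z) refl

        -- The + 0 are the (vanishing) incoming twists of the cross and the x-box.
        termˡ : (F : ℕ → ℕ → ℕ → ℕ → Carrier) (m : ℕ) (i₁ j₁ k₁ i₃ j₃ k₃ : Bool) →
                Bool × Bool × Bool → Factor × Carrier
        termˡ F m i₁ j₁ k₁ i₃ j₃ k₃ (a , b , c) =
          site u 𝟙 i₁ j₁ a b ⊛ site x 𝟙 k₁ b c j₃ ⊛ site y ⟨ pow t m ⟩ c a k₃ i₃ ,
          F ((b2n a ∸ b2n j₁) +ℕ m) (b2n b +ℕ 0) (b2n j₃ +ℕ 0) (b2n i₃ +ℕ m)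

        termʳ : (G : ℕ → ℕ → ℕ → ℕ → Carrier) (m : ℕ) (i₁ j₁ k₁ i₃ j₃ k₃ : Bool) →
                Bool × Bool × Bool → Factor × Carrier
        termʳ G m i₁ j₁ k₁ i₃ j₃ k₃ (a , b , c) =
          site y ⟨ pow t m ⟩ k₁ i₁ c a ⊛ site x 𝟙 c j₁ k₃ b ⊛ site u 𝟙 a b i₃ j₃ ,
          G ((b2n i₃ ∸ b2n b) +ℕ m) (b2n j₃ +ℕ 0) (b2n b +ℕ 0) (b2n a +ℕ m)

        siteˡ : (F : ℕ → ℕ → ℕ → ℕ → Carrier) (m : ℕ) (i₁ j₁ k₁ i₃ j₃ k₃ : Bool) → Carrier
        siteˡ F m i₁ j₁ k₁ i₃ j₃ k₃ = Σᶠ (nonzero (map (termˡ F m i₁ j₁ k₁ i₃ j₃ k₃) triples))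

        siteʳ : (G : ℕ → ℕ → ℕ → ℕ → Carrier) (m : ℕ) (i₁ j₁ k₁ i₃ j₃ k₃ : Bool) → Carrier
        siteʳ G m i₁ j₁ k₁ i₃ j₃ k₃ = Σᶠ (nonzero (map (termʳ G m i₁ j₁ k₁ i₃ j₃ k₃) triples))

        lhs-∷ : ∀ {k} m i₁ j₁ k₁ i₃ j₃ k₃ (I₁ J₁ K₁ I₃ J₃ K₃ : Vec Bool k) →
          lhs (suc k) m 0 0 m (i₁ ∷ I₁) (j₁ ∷ J₁) (k₁ ∷ K₁) (i₃ ∷ I₃) (j₃ ∷ J₃) (k₃ ∷ K₃) ≈
          siteˡ (λ m r s q → lhs k m r s q I₁ J₁ K₁ I₃ J₃ K₃) m i₁ j₁ k₁ i₃ j₃ k₃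
        lhs-∷ {k} m i₁ j₁ k₁ i₃ j₃ k₃ I₁ J₁ K₁ I₃ J₃ K₃ = begin
          lhs (suc k) m 0 0 m (i₁ ∷ I₁) (j₁ ∷ J₁) (k₁ ∷ K₁) (i₃ ∷ I₃) (j₃ ∷ J₃) (k₃ ∷ K₃)
            ≈⟨ Σ³-∷ k _ ⟩
          sumL bools (λ a → sumL bools (λ b → sumL bools (λ c → Σ³ k (λ A B C →
            (cross m 0 (i₁ ∷ I₁) (j₁ ∷ J₁) (a ∷ A) (b ∷ B) * box x 0 (k₁ ∷ K₁) (b ∷ B) (c ∷ C) (j₃ ∷ J₃))
              * box y m (c ∷ C) (a ∷ A) (k₃ ∷ K₃) (i₃ ∷ I₃)))))
            ≈⟨ sumL-cong bools (λ a → sumL-cong bools (λ b → sumL-cong bools (λ c →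
                 trans (Σ³-cong k (λ A B C →
                          trans (*-cong (*-cong (weight-∷ (poch u t) m u 0 𝟙 refl i₁ j₁ a b I₁ J₁ A B)
                                                (weight-∷ (λ _ → 1#) 0 x 0 𝟙 refl k₁ b c j₃ K₁ B C J₃))
                                        (weight-∷ (λ _ → 1#) 0 y m ⟨ pow t m ⟩ refl c a k₃ i₃ C A K₃ I₃))
                                (·-*-·-*-· (site u 𝟙 i₁ j₁ a b) (site x 𝟙 k₁ b c j₃)
                                           (site y ⟨ pow t m ⟩ c a k₃ i₃) _ _ _)))
                       (Σ³-· k (coefficient a b c) (λ A B C →
                          (cross ((b2n a ∸ b2n j₁) +ℕ m) (b2n b +ℕ 0) I₁ J₁ A B * box x (b2n j₃ +ℕ 0) K₁ B C J₃)
                            * box y (b2n i₃ +ℕ m) C A K₃ I₃))))) ⟩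
          sumL bools (λ a → sumL bools (λ b → sumL bools (λ c → uncurry _·_ (term (a , b , c)))))
            ≈⟨ sumL-triples (λ p → uncurry _·_ (term p)) ⟨
          sumL triples (λ p → uncurry _·_ (term p))
            ≈⟨ Σᶠ-nonzero triples term ⟨
          siteˡ F m i₁ j₁ k₁ i₃ j₃ k₃ ∎
          where
          F : ℕ → ℕ → ℕ → ℕ → Carrier
          F m r s q = lhs k m r s q I₁ J₁ K₁ I₃ J₃ K₃
          term : Bool × Bool × Bool → Factor × Carrier
          term = termˡ F m i₁ j₁ k₁ i₃ j₃ k₃
          coefficient : Bool → Bool → Bool → Factor
          coefficient a b c = site u 𝟙 i₁ j₁ a b ⊛ site x 𝟙 k₁ b c j₃ ⊛ site y ⟨ pow t m ⟩ c a k₃ i₃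

        rhs-∷ : ∀ {k} m i₁ j₁ k₁ i₃ j₃ k₃ (I₁ J₁ K₁ I₃ J₃ K₃ : Vec Bool k) →
          rhs (suc k) m 0 0 m (i₁ ∷ I₁) (j₁ ∷ J₁) (k₁ ∷ K₁) (i₃ ∷ I₃) (j₃ ∷ J₃) (k₃ ∷ K₃) ≈
          siteʳ (λ m r s q → rhs k m r s q I₁ J₁ K₁ I₃ J₃ K₃) m i₁ j₁ k₁ i₃ j₃ k₃
        rhs-∷ {k} m i₁ j₁ k₁ i₃ j₃ k₃ I₁ J₁ K₁ I₃ J₃ K₃ = begin
          rhs (suc k) m 0 0 m (i₁ ∷ I₁) (j₁ ∷ J₁) (k₁ ∷ K₁) (i₃ ∷ I₃) (j₃ ∷ J₃) (k₃ ∷ K₃)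
            ≈⟨ Σ³-∷ k _ ⟩
          sumL bools (λ a → sumL bools (λ b → sumL bools (λ c → Σ³ k (λ A B C →
            (box y m (k₁ ∷ K₁) (i₁ ∷ I₁) (c ∷ C) (a ∷ A) * box x 0 (c ∷ C) (j₁ ∷ J₁) (k₃ ∷ K₃) (b ∷ B))
              * cross m 0 (a ∷ A) (b ∷ B) (i₃ ∷ I₃) (j₃ ∷ J₃)))))
            ≈⟨ sumL-cong bools (λ a → sumL-cong bools (λ b → sumL-cong bools (λ c →
                 trans (Σ³-cong k (λ A B C →
                          trans (*-cong (*-cong (weight-∷ (λ _ → 1#) 0 y m ⟨ pow t m ⟩ refl k₁ i₁ c a K₁ I₁ C A)
                                                (weight-∷ (λ _ → 1#) 0 x 0 𝟙 refl c j₁ k₃ b C J₁ K₃ B))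
                                        (weight-∷ (poch u t) m u 0 𝟙 refl a b i₃ j₃ A B I₃ J₃))
                                (·-*-·-*-· (site y ⟨ pow t m ⟩ k₁ i₁ c a) (site x 𝟙 c j₁ k₃ b)
                                           (site u 𝟙 a b i₃ j₃) _ _ _)))
                       (Σ³-· k (coefficient a b c) (λ A B C →
                          (box y (b2n a +ℕ m) K₁ I₁ C A * box x (b2n b +ℕ 0) C J₁ K₃ B)
                            * cross ((b2n i₃ ∸ b2n b) +ℕ m) (b2n j₃ +ℕ 0) A B I₃ J₃))))) ⟩
          sumL bools (λ a → sumL bools (λ b → sumL bools (λ c → uncurry _·_ (term (a , b , c)))))
            ≈⟨ sumL-triples (λ p → uncurry _·_ (term p)) ⟨
          sumL triples (λ p → uncurry _·_ (term p))
            ≈⟨ Σᶠ-nonzero triples term ⟨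
          siteʳ G m i₁ j₁ k₁ i₃ j₃ k₃ ∎
          where
          G : ℕ → ℕ → ℕ → ℕ → Carrier
          G m r s q = rhs k m r s q I₁ J₁ K₁ I₃ J₃ K₃
          term : Bool × Bool × Bool → Factor × Carrier
          term = termʳ G m i₁ j₁ k₁ i₃ j₃ k₃
          coefficient : Bool → Bool → Bool → Factor
          coefficient a b c = site y ⟨ pow t m ⟩ k₁ i₁ c a ⊛ site x 𝟙 c j₁ k₃ b ⊛ site u 𝟙 a b i₃ j₃

        record TailLaws (F G : ℕ → ℕ → ℕ → ℕ → Carrier) (T₁ T₂ : Carrier) : Set (c ⊔ ℓ) where
          field
            F-twistˣ : ∀ m r s q → F m r (suc s) q ≈ T₂ * F m r s q
            G-twistˣ : ∀ m r s q → G m r (suc s) q ≈ T₁ * G m r s q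
            F-twistʸ : ∀ m r s q → F m (suc r) s (suc q) ≈ T₁ * F m r s q
            G-twistʸ : ∀ m r s q → G m (suc r) s (suc q) ≈ T₂ * G m r s q
            F-shift  : ∀ m s q → (u * pow t m) * F m 1 s q + F (suc m) 0 s q ≈ F m 0 s q

        tailLaws : ∀ {k} (I₁ J₁ K₁ I₃ J₃ K₃ : Vec Bool k) →
          TailLaws (λ m r s q → lhs k m r s q I₁ J₁ K₁ I₃ J₃ K₃) (λ m r s q → rhs k m r s q I₁ J₁ K₁ I₃ J₃ K₃)
                   (pow t (∣ K₃ ∣ ∸ ∣ J₁ ∣)) (pow t (∣ K₁ ∣ ∸ ∣ J₃ ∣))
        tailLaws I₁ J₁ K₁ I₃ J₃ K₃ = record
          { F-twistˣ = lhs-twistˣ I₁ J₁ K₁ I₃ J₃ K₃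
          ; G-twistˣ = rhs-twistˣ I₁ J₁ K₁ I₃ J₃ K₃
          ; F-twistʸ = lhs-twistʸ I₁ J₁ K₁ I₃ J₃ K₃
          ; G-twistʸ = rhs-twistʸ I₁ J₁ K₁ I₃ J₃ K₃
          ; F-shift  = lhs-shift I₁ J₁ K₁ I₃ J₃ K₃
          }

        module SiteIdentity (uy≈x : u * y ≈ x) {F G : ℕ → ℕ → ℕ → ℕ → Carrier} {T₁ T₂ : Carrier}
                            (laws : TailLaws F G T₁ T₂) (diagonal : ∀ m → F m 0 0 m ≈ G m 0 0 m) where
          open TailLaws laws

          yu≈x : y * u ≈ x
          yu≈x = trans (*-comm y u) uy≈x

          xF≈yuG : ∀ m → x * F m 0 1 m ≈ (y * u) * G m 1 0 (suc m)
          xF≈yuG m = begin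
            x * F m 0 1 m               ≈⟨ *-cong (sym yu≈x) (F-twistˣ m 0 0 m) ⟩
            (y * u) * (T₂ * F m 0 0 m)  ≈⟨ *-congˡ (*-congˡ (diagonal m)) ⟩
            (y * u) * (T₂ * G m 0 0 m)  ≈⟨ *-congˡ (G-twistʸ m 0 0 m) ⟨
            (y * u) * G m 1 0 (suc m)   ∎

          uyF≈xG : ∀ m → (u * y) * F m 1 0 (suc m) ≈ x * G m 0 1 m
          uyF≈xG m = begin
            (u * y) * F m 1 0 (suc m)  ≈⟨ *-cong uy≈x (F-twistʸ m 0 0 m) ⟩
            x * (T₁ * F m 0 0 m)       ≈⟨ *-congˡ (*-congˡ (diagonal m)) ⟩
            x * (T₁ * G m 0 0 m)       ≈⟨ *-congˡ (G-twistˣ m 0 0 m) ⟨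
            x * G m 0 1 m              ∎

          utF+F≈G : ∀ m → (u * pow t m) * F m 1 0 m + F (suc m) 0 0 m ≈ G m 0 0 m
          utF+F≈G m = trans (F-shift m 0 m) (diagonal m)

          yF≈txG+yG : ∀ m → y * F m 0 0 (suc m) ≈ (pow t m * x) * G m 0 1 m + y * G (suc m) 0 0 (suc m)
          yF≈txG+yG m = begin
            y * F m 0 0 (suc m)
              ≈⟨ *-congˡ (F-shift m 0 (suc m)) ⟨
            y * ((u * pow t m) * F m 1 0 (suc m) + F (suc m) 0 0 (suc m))
              ≈⟨ *-congˡ (+-cong (*-congˡ (trans (F-twistʸ m 0 0 m) (*-congˡ (diagonal m)))) (diagonal (suc m))) ⟩
            y * ((u * pow t m) * (T₁ * G m 0 0 m) + G (suc m) 0 0 (suc m))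
              ≈⟨ solve 6 (λ y′ u′ tᵐ T Z Z′ → y′ :* ((u′ :* tᵐ) :* (T :* Z) :+ Z′)
                                              := (tᵐ :* (u′ :* y′)) :* (T :* Z) :+ y′ :* Z′)
                   refl y u (pow t m) T₁ _ _ ⟩
            (pow t m * (u * y)) * (T₁ * G m 0 0 m) + y * G (suc m) 0 0 (suc m)
              ≈⟨ +-congʳ (*-cong (*-congˡ uy≈x) (sym (G-twistˣ m 0 0 m))) ⟩
            (pow t m * x) * G m 0 1 m + y * G (suc m) 0 0 (suc m) ∎

          uxtF+xF≈yuG : ∀ m → ((u * x) * pow t m) * F m 1 1 m + x * F (suc m) 0 1 m ≈ (y * u) * G m 1 0 (suc m)
          uxtF+xF≈yuG m = begin
            ((u * x) * pow t m) * F m 1 1 m + x * F (suc m) 0 1 m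
              ≈⟨ +-cong (*-congˡ (F-twistˣ m 1 0 m)) (*-congˡ (F-twistˣ (suc m) 0 0 m)) ⟩
            ((u * x) * pow t m) * (T₂ * F m 1 0 m) + x * (T₂ * F (suc m) 0 0 m)
              ≈⟨ solve 6 (λ u′ x′ tᵐ T Z Z′ → ((u′ :* x′) :* tᵐ) :* (T :* Z) :+ x′ :* (T :* Z′)
                                             := x′ :* (T :* ((u′ :* tᵐ) :* Z :+ Z′)))
                   refl u x (pow t m) T₂ _ _ ⟩
            x * (T₂ * ((u * pow t m) * F m 1 0 m + F (suc m) 0 0 m))
              ≈⟨ *-cong (sym yu≈x) (*-congˡ (utF+F≈G m)) ⟩
            (y * u) * (T₂ * G m 0 0 m)
              ≈⟨ *-congˡ (G-twistʸ m 0 0 m) ⟨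
            (y * u) * G m 1 0 (suc m) ∎

          uxyF≈yxuG : ∀ m → ((u * x) * y) * F m 1 1 (suc m) ≈ ((y * x) * u) * G m 1 1 (suc m)
          uxyF≈yxuG m = begin
            ((u * x) * y) * F m 1 1 (suc m)
              ≈⟨ *-congˡ (trans (F-twistʸ m 0 1 m) (*-congˡ (F-twistˣ m 0 0 m))) ⟩
            ((u * x) * y) * (T₁ * (T₂ * F m 0 0 m))
              ≈⟨ solve 6 (λ u′ x′ y′ T T′ Z → ((u′ :* x′) :* y′) :* (T :* (T′ :* Z))
                                             := ((y′ :* x′) :* u′) :* (T′ :* (T :* Z)))
                   refl u x y T₁ T₂ _ ⟩
            ((y * x) * u) * (T₂ * (T₁ * F m 0 0 m))
              ≈⟨ *-congˡ (*-congˡ (*-congˡ (diagonal m))) ⟩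
            ((y * x) * u) * (T₂ * (T₁ * G m 0 0 m))
              ≈⟨ *-congˡ (trans (G-twistʸ m 0 1 m) (*-congˡ (G-twistˣ m 0 0 m))) ⟨
            ((y * x) * u) * G m 1 1 (suc m) ∎

          -- Rows are (i₁ j₁ k₁ i₃ j₃ k₃); in the refl rows neither side has an admissible
          -- internal configuration.
          site-identity : ∀ m i₁ j₁ k₁ i₃ j₃ k₃ → siteˡ F m i₁ j₁ k₁ i₃ j₃ k₃ ≈ siteʳ G m i₁ j₁ k₁ i₃ j₃ k₃
          site-identity m false false false false false false = diagonal m
          site-identity m false false false false false true  = refl
          site-identity m false false false false true  false = refl
          site-identity m false false false false true  true  = refl
          site-identity m false false false true  false false = refl
          site-identity m false false false true  false true  = refl
          site-identity m false false false true  true  false = refl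
          site-identity m false false false true  true  true  = refl
          site-identity m false false true  false false false = refl
          site-identity m false false true  false false true  = *-congˡ (diagonal m)
          site-identity m false false true  false true  false = xF≈yuG m
          site-identity m false false true  false true  true  = refl
          site-identity m false false true  true  false false = yF≈txG+yG m
          site-identity m false false true  true  false true  = refl
          site-identity m false false true  true  true  false = refl
          site-identity m false false true  true  true  true  = refl
          site-identity m false true  false false false false = refl
          site-identity m false true  false false false true  = diagonal m
          site-identity m false true  false false true  false = refl
          site-identity m false true  false false true  true  = refl
          site-identity m false true  false true  false false = refl
          site-identity m false true  false true  false true  = refl
          site-identity m false true  false true  true  false = refl
          site-identity m false true  false true  true  true  = refl
          site-identity m false true  true  false false false = refl
          site-identity m false true  true  false false true  = refl
          site-identity m false true  true  false true  false = refl
          site-identity m false true  true  false true  true  = xF≈yuG m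
          site-identity m false true  true  true  false false = refl
          site-identity m false true  true  true  false true  = yF≈txG+yG m
          site-identity m false true  true  true  true  false = refl
          site-identity m false true  true  true  true  true  = refl
          site-identity m true  false false false false false = refl
          site-identity m true  false false false false true  = utF+F≈G m
          site-identity m true  false false false true  false = refl
          site-identity m true  false false false true  true  = refl
          site-identity m true  false false true  false false = uyF≈xG m
          site-identity m true  false false true  false true  = refl
          site-identity m true  false false true  true  false = refl
          site-identity m true  false false true  true  true  = refl
          site-identity m true  false true  false false false = refl
          site-identity m true  false true  false false true  = refl
          site-identity m true  false true  false true  false = refl
          site-identity m true  false true  false true  true  = uxtF+xF≈yuG m
          site-identity m true  false true  true  false false = refl
          site-identity m true  false true  true  false true  = *-congˡ (diagonal (suc m))
          site-identity m true  false true  true  true  false = uxyF≈yxuG m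
          site-identity m true  false true  true  true  true  = refl
          site-identity m true  true  false false false false = refl
          site-identity m true  true  false false false true  = refl
          site-identity m true  true  false false true  false = refl
          site-identity m true  true  false false true  true  = refl
          site-identity m true  true  false true  false false = refl
          site-identity m true  true  false true  false true  = uyF≈xG m
          site-identity m true  true  false true  true  false = refl
          site-identity m true  true  false true  true  true  = refl
          site-identity m true  true  true  false false false = refl
          site-identity m true  true  true  false false true  = refl
          site-identity m true  true  true  false true  false = refl
          site-identity m true  true  true  false true  true  = refl
          site-identity m true  true  true  true  false false = refl
          site-identity m true  true  true  true  false true  = refl
          site-identity m true  true  true  true  true  false = refl
          site-identity m true  true  true  true  true  true  = uxyF≈yxuG m

        lhs≈rhs : u * y ≈ x → ∀ k m (I₁ J₁ K₁ I₃ J₃ K₃ : Vec Bool k) →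
                  lhs k m 0 0 m I₁ J₁ K₁ I₃ J₃ K₃ ≈ rhs k m 0 0 m I₁ J₁ K₁ I₃ J₃ K₃
        lhs≈rhs uy≈x zero m [] [] [] [] [] [] =
          begin
          lhs 0 m 0 0 m [] [] [] [] [] []
            ≈⟨ Σ³-[] (λ A B C → (cross m 0 [] [] A B * box x 0 [] B C []) * box y m C A [] []) ⟩
          (cross m 0 [] [] [] [] * box x 0 [] [] [] []) * box y m [] [] [] []   ≈⟨ xy∙z≈zy∙x _ _ _ ⟩
          (box y m [] [] [] [] * box x 0 [] [] [] []) * cross m 0 [] [] [] []
            ≈⟨ Σ³-[] (λ A B C → (box y m [] [] C A * box x 0 C [] [] B) * cross m 0 A B [] []) ⟨
          rhs 0 m 0 0 m [] [] [] [] [] []                                         ∎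
        lhs≈rhs uy≈x (suc k) m (i₁ ∷ I₁) (j₁ ∷ J₁) (k₁ ∷ K₁) (i₃ ∷ I₃) (j₃ ∷ J₃) (k₃ ∷ K₃) = begin
          lhs (suc k) m 0 0 m (i₁ ∷ I₁) (j₁ ∷ J₁) (k₁ ∷ K₁) (i₃ ∷ I₃) (j₃ ∷ J₃) (k₃ ∷ K₃)
            ≈⟨ lhs-∷ m i₁ j₁ k₁ i₃ j₃ k₃ I₁ J₁ K₁ I₃ J₃ K₃ ⟩
          siteˡ (λ m r s q → lhs k m r s q I₁ J₁ K₁ I₃ J₃ K₃) m i₁ j₁ k₁ i₃ j₃ k₃
            ≈⟨ SiteIdentity.site-identity uy≈x (tailLaws I₁ J₁ K₁ I₃ J₃ K₃)
                 (λ m′ → lhs≈rhs uy≈x k m′ I₁ J₁ K₁ I₃ J₃ K₃) m i₁ j₁ k₁ i₃ j₃ k₃ ⟩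
          siteʳ (λ m r s q → rhs k m r s q I₁ J₁ K₁ I₃ J₃ K₃) m i₁ j₁ k₁ i₃ j₃ k₃
            ≈⟨ rhs-∷ m i₁ j₁ k₁ i₃ j₃ k₃ I₁ J₁ K₁ I₃ J₃ K₃ ⟨
          rhs (suc k) m 0 0 m (i₁ ∷ I₁) (j₁ ∷ J₁) (k₁ ∷ K₁) (i₃ ∷ I₃) (j₃ ∷ J₃) (k₃ ∷ K₃) ∎

proposition3p4 : {c ℓ : Level} (R : CommutativeRing c ℓ) (k : ℕ)
    (x y t u : CommutativeRing.Carrier R) →
    CommutativeRing._≈_ R (CommutativeRing._*_ R u y) x →
    (I₁ J₁ K₁ I₃ J₃ K₃ : Vec Bool k) →
    let open CommutativeRing R
        open Weights R
    in Σ𝟚 k (λ A → Σ𝟚 k (λ B → Σ𝟚 k (λ C →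
          (R'' u t I₁ J₁ A B * P x t K₁ B C J₃) * P y t C A K₃ I₃)))
       ≈ Σ𝟚 k (λ A → Σ𝟚 k (λ B → Σ𝟚 k (λ C →
          (P y t K₁ I₁ C A * P x t C J₁ K₃ B) * R'' u t A B I₃ J₃)))
proposition3p4 R k x y t u uy≈x I₁ J₁ K₁ I₃ J₃ K₃ = begin
  Σ³ k (λ A B C → (R'' u t I₁ J₁ A B * P x t K₁ B C J₃) * P y t C A K₃ I₃)
    ≈⟨ Σ³-cong k (λ A B C → *-cong (*-cong (R''≈cross t u I₁ J₁ A B) (P≈box t x K₁ B C J₃))
                                   (P≈box t y C A K₃ I₃)) ⟩
  lhs t u x y k 0 0 0 0 I₁ J₁ K₁ I₃ J₃ K₃
    ≈⟨ lhs≈rhs t u x y uy≈x k 0 I₁ J₁ K₁ I₃ J₃ K₃ ⟩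
  rhs t u x y k 0 0 0 0 I₁ J₁ K₁ I₃ J₃ K₃
    ≈⟨ Σ³-cong k (λ A B C → *-cong (*-cong (P≈box t y K₁ I₁ C A) (P≈box t x C J₁ K₃ B))
                                   (R''≈cross t u A B I₃ J₃)) ⟨
  Σ³ k (λ A B C → (P y t K₁ I₁ C A * P x t C J₁ K₃ B) * R'' u t A B I₃ J₃) ∎
  where
  open CommutativeRing R
  open Weights R
  open Proof R
  open import Relation.Binary.Reasoning.Setoid setoid
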